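{- For every nonnegative integer $n$, $$\sum_{\substack{i+j=n\\ i,j\ge0}} B_{2i}B_{2j}-\sum_{\substack{i+j=n\\ i\ge 0,\ j\ge1}} B_{2i+1}B_{2j-1}=\sum_{\substack{i+j=n\\ i,j\ge0}} C_{2i}B_{2j}.$$
   Context: For a nonnegative integer $m$, $C_m=\frac{1}{m+1}\binom{2m}{m}$ is the $m$th Catalan number and $B_m=\binom{2m}{m}$ is the $m$th central binomial coefficient. -}

module Defs where

open import Data.Nat using (ℕ; zero; suc; _+_; _*_; _∸_; _/_)
open import Data.Nat.Combinatorics using (_C_)
open import Data.List using (List; map; upTo)
open import Data.Nat.ListAction using (sum)

B : ℕ → ℕ
B m = (2 * m) C m

-- Catalan number C_m = binom(2m, m) / (m + 1)  (exact division)
Cat : ℕ → ℕ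
Cat m = B m / suc m

Σ< : ℕ → (ℕ → ℕ) → ℕ
Σ< n f = sum (map f (upTo n))

-- Let (B⋆B) m = Σ_{k ≤ m} B_k B_{m-k}. Splitting the weight m+1 = k + (m+1-k) in
-- (m+1)·(B⋆B)(m+1) and using (k+1) B_{k+1} = 2(2k+1) B_k on both halves gives
-- (B⋆B)(m+1) = 4·(B⋆B) m, so (B⋆B) m = 4^m. Sorting the terms by the parity of k,
-- (B⋆B)(2n) = E + X with E, X the two sums on the left, while by symmetry (B⋆B)(2n+1) = 2Y with
-- Y = Σ B_{2i+1} B_{2n-2i}; hence Y = 2(E + X). Termwise, 2C_m + B_{m+1} = 4B_m gives
-- 2R + Y = 4E for the right-hand side R, and eliminating Y leaves E = R + X.

module Submission where

open import Data.List using ([_]; _∷ʳ_; applyUpTo)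
open import Data.List.Properties using (map-upTo; applyUpTo-∷ʳ)
open import Data.Nat
open import Data.Nat.Combinatorics
open import Data.Nat.DivMod using (m/n*n≡m)
open import Data.Nat.Divisibility using (_∣_; divides)
open import Data.Nat.ListAction using (sum)
open import Data.Nat.ListAction.Properties using (sum-++)
open import Data.Nat.Properties
open import Data.Nat.Tactic.RingSolver using (solve-∀)
open import Function using (_∘_)
open import Relation.Binary.PropositionalEquality using (_≡_; refl; sym; trans; cong; cong₂; module ≡-Reasoning)
open import Relation.Nullary using (yes; no)

open import Defs

open ≡-Reasoning

nCk*k!*[n∸k]!≡n! : ∀ {n k} → k ≤ n → (n C k) * (k ! * (n ∸ k) !) ≡ n !
nCk*k!*[n∸k]!≡n! {n} {k} k≤n = begin
  (n C k) * (k ! * (n ∸ k) !)                        ≡⟨ cong (_* (k ! * (n ∸ k) !)) (nCk≡n!/k![n-k]! k≤n) ⟩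
  (n ! / (k ! * (n ∸ k) !)) * (k ! * (n ∸ k) !)      ≡⟨ m/n*n≡m (k![n∸k]!∣n! k≤n) ⟩
  n !                                                ∎
  where instance _ = k !* (n ∸ k) !≢0

[1+k]*[1+n]C[1+k]≡[1+n]*nCk : ∀ n k → suc k * (suc n C suc k) ≡ suc n * (n C k)
[1+k]*[1+n]C[1+k]≡[1+n]*nCk n k with k ≤? n
... | no k≰n = begin
  suc k * (suc n C suc k)  ≡⟨ cong (suc k *_) (k>n⇒nCk≡0 (s<s (≰⇒> k≰n))) ⟩
  suc k * 0                ≡⟨ *-zeroʳ (suc k) ⟩
  0                        ≡⟨ *-zeroʳ (suc n) ⟨
  suc n * 0                ≡⟨ cong (suc n *_) (k>n⇒nCk≡0 (≰⇒> k≰n)) ⟨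
  suc n * (n C k)          ∎
... | yes k≤n = *-cancelʳ-≡ _ _ d {{k !* (n ∸ k) !≢0}} (begin
  suc k * (suc n C suc k) * d          ≡⟨ shuffle (suc k) (suc n C suc k) (k !) ((n ∸ k) !) ⟩
  (suc n C suc k) * (suc k ! * (n ∸ k) !) ≡⟨ nCk*k!*[n∸k]!≡n! (s≤s k≤n) ⟩
  suc n * n !                          ≡⟨ cong (suc n *_) (nCk*k!*[n∸k]!≡n! k≤n) ⟨
  suc n * ((n C k) * d)                ≡⟨ *-assoc (suc n) (n C k) d ⟨
  suc n * (n C k) * d                  ∎)
  where
  d = k ! * (n ∸ k) !
  shuffle : ∀ a c x y → a * c * (x * y) ≡ c * (a * x * y)
  shuffle = solve-∀

[1+2m]Cm≡[1+2m]C[1+m] : ∀ m → suc (2 * m) C m ≡ suc (2 * m) C suc m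
[1+2m]Cm≡[1+2m]C[1+m] m = begin
  suc (2 * m) C m                 ≡⟨ nCk≡nC[n∸k] (m≤n⇒m≤1+n (m≤m+n m (m + 0))) ⟩
  suc (2 * m) C (suc (2 * m) ∸ m) ≡⟨ cong (λ t → suc (2 * m) C (suc (m + t) ∸ m)) (+-identityʳ m) ⟩
  suc (2 * m) C (suc m + m ∸ m)   ≡⟨ cong (suc (2 * m) C_) (m+n∸n≡m (suc m) m) ⟩
  suc (2 * m) C suc m             ∎

B[1+m]≡2*[1+2m]C[1+m] : ∀ m → B (suc m) ≡ 2 * (suc (2 * m) C suc m)
B[1+m]≡2*[1+2m]C[1+m] m = *-cancelˡ-≡ _ _ (suc m) (begin
  suc m * B (suc m)                          ≡⟨ cong (λ t → suc m * (t C suc m)) (*-suc 2 m) ⟩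
  suc m * (suc (suc (2 * m)) C suc m)        ≡⟨ [1+k]*[1+n]C[1+k]≡[1+n]*nCk (suc (2 * m)) m ⟩
  suc (suc (2 * m)) * (suc (2 * m) C m)      ≡⟨ cong (suc (suc (2 * m)) *_) ([1+2m]Cm≡[1+2m]C[1+m] m) ⟩
  suc (suc (2 * m)) * (suc (2 * m) C suc m)  ≡⟨ factor-suc m (suc (2 * m) C suc m) ⟩
  suc m * (2 * (suc (2 * m) C suc m))        ∎)
  where
  factor-suc : ∀ m x → suc (suc (2 * m)) * x ≡ suc m * (2 * x)
  factor-suc = solve-∀

[1+m]*B[1+m]≡2[1+2m]*Bm : ∀ m → suc m * B (suc m) ≡ 2 * suc (2 * m) * B m
[1+m]*B[1+m]≡2[1+2m]*Bm m = begin
  suc m * B (suc m)                      ≡⟨ cong (suc m *_) (B[1+m]≡2*[1+2m]C[1+m] m) ⟩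
  suc m * (2 * (suc (2 * m) C suc m))    ≡⟨ x*[2*y]≡2*[x*y] (suc m) (suc (2 * m) C suc m) ⟩
  2 * (suc m * (suc (2 * m) C suc m))    ≡⟨ cong (2 *_) ([1+k]*[1+n]C[1+k]≡[1+n]*nCk (2 * m) m) ⟩
  2 * (suc (2 * m) * B m)                ≡⟨ *-assoc 2 (suc (2 * m)) (B m) ⟨
  2 * suc (2 * m) * B m                  ∎
  where
  x*[2*y]≡2*[x*y] : ∀ x y → x * (2 * y) ≡ 2 * (x * y)
  x*[2*y]≡2*[x*y] = solve-∀

[1+m]*[2m]C[1+m]≡m*Bm : ∀ m → suc m * ((2 * m) C suc m) ≡ m * B m
[1+m]*[2m]C[1+m]≡m*Bm m = +-cancelˡ-≡ (suc m * B m) _ _ (begin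
  suc m * B m + suc m * ((2 * m) C suc m)  ≡⟨ *-distribˡ-+ (suc m) (B m) ((2 * m) C suc m) ⟨
  suc m * (B m + (2 * m) C suc m)          ≡⟨ cong (suc m *_) (nCk+nC[k+1]≡[n+1]C[k+1] (2 * m) m) ⟩
  suc m * (suc (2 * m) C suc m)            ≡⟨ [1+k]*[1+n]C[1+k]≡[1+n]*nCk (2 * m) m ⟩
  suc (2 * m) * B m                        ≡⟨ split-suc m (B m) ⟩
  suc m * B m + m * B m                    ∎)
  where
  split-suc : ∀ m b → suc (2 * m) * b ≡ suc m * b + m * b
  split-suc = solve-∀

-- The quotient is the classical C_m = binom(2m, m) - binom(2m, m+1).
[1+m]∣Bm : ∀ m → suc m ∣ B m
[1+m]∣Bm m = divides (B m ∸ X) (sym (begin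
  (B m ∸ X) * suc m          ≡⟨ *-distribʳ-∸ (suc m) (B m) X ⟩
  B m * suc m ∸ X * suc m    ≡⟨ cong₂ _∸_ (*-suc (B m) m) (*-comm X (suc m)) ⟩
  B m + B m * m ∸ suc m * X  ≡⟨ cong (B m + B m * m ∸_) (trans ([1+m]*[2m]C[1+m]≡m*Bm m) (*-comm m (B m))) ⟩
  B m + B m * m ∸ B m * m    ≡⟨ m+n∸n≡m (B m) (B m * m) ⟩
  B m                        ∎))
  where X = (2 * m) C suc m

[1+m]*Cat≡B : ∀ m → suc m * Cat m ≡ B m
[1+m]*Cat≡B m = trans (*-comm (suc m) (Cat m)) (m/n*n≡m ([1+m]∣Bm m))

2*Cat+B[1+m]≡4*B : ∀ m → 2 * Cat m + B (suc m) ≡ 4 * B m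
2*Cat+B[1+m]≡4*B m = *-cancelˡ-≡ _ _ (suc m) (begin
  suc m * (2 * Cat m + B (suc m))              ≡⟨ distrib (suc m) (Cat m) (B (suc m)) ⟩
  2 * (suc m * Cat m) + suc m * B (suc m)      ≡⟨ cong₂ (λ x y → 2 * x + y) ([1+m]*Cat≡B m) ([1+m]*B[1+m]≡2[1+2m]*Bm m) ⟩
  2 * B m + 2 * suc (2 * m) * B m              ≡⟨ collect m (B m) ⟩
  suc m * (4 * B m)                            ∎)
  where
  distrib : ∀ a c b → a * (2 * c + b) ≡ 2 * (a * c) + a * b
  distrib = solve-∀
  collect : ∀ m b → 2 * b + 2 * suc (2 * m) * b ≡ suc m * (4 * b)
  collect = solve-∀

Σ<-suc : ∀ n f → Σ< (suc n) f ≡ f 0 + Σ< n (f ∘ suc)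
Σ<-suc n f = begin
  Σ< (suc n) f                         ≡⟨ cong sum (map-upTo f (suc n)) ⟩
  f 0 + sum (applyUpTo (f ∘ suc) n)    ≡⟨ cong (λ xs → f 0 + sum xs) (map-upTo (f ∘ suc) n) ⟨
  f 0 + Σ< n (f ∘ suc)                 ∎

Σ<-snoc : ∀ n f → Σ< (suc n) f ≡ Σ< n f + f n
Σ<-snoc n f = begin
  Σ< (suc n) f                               ≡⟨ cong sum (map-upTo f (suc n)) ⟩
  sum (applyUpTo f (suc n))                  ≡⟨ cong sum (applyUpTo-∷ʳ f n) ⟨
  sum (applyUpTo f n ∷ʳ f n)                 ≡⟨ sum-++ (applyUpTo f n) [ f n ] ⟩
  sum (applyUpTo f n) + (f n + 0)            ≡⟨ cong₂ _+_ (sym (cong sum (map-upTo f n))) (+-identityʳ (f n)) ⟩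
  Σ< n f + f n                               ∎

Σ<-cong : ∀ n {f g : ℕ → ℕ} → (∀ {k} → k < n → f k ≡ g k) → Σ< n f ≡ Σ< n g
Σ<-cong zero    f≗g = refl
Σ<-cong (suc n) {f} {g} f≗g = begin
  Σ< (suc n) f          ≡⟨ Σ<-suc n f ⟩
  f 0 + Σ< n (f ∘ suc)  ≡⟨ cong₂ _+_ (f≗g z<s) (Σ<-cong n (f≗g ∘ s<s)) ⟩
  g 0 + Σ< n (g ∘ suc)  ≡⟨ Σ<-suc n g ⟨
  Σ< (suc n) g          ∎

Σ<-+ : ∀ n (f g : ℕ → ℕ) → Σ< n (λ k → f k + g k) ≡ Σ< n f + Σ< n g
Σ<-+ zero    f g = refl
Σ<-+ (suc n) f g = begin
  Σ< (suc n) (λ k → f k + g k)                    ≡⟨ Σ<-suc n (λ k → f k + g k) ⟩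
  f 0 + g 0 + Σ< n (λ k → f (suc k) + g (suc k))  ≡⟨ cong (f 0 + g 0 +_) (Σ<-+ n (f ∘ suc) (g ∘ suc)) ⟩
  f 0 + g 0 + (Σ< n (f ∘ suc) + Σ< n (g ∘ suc))   ≡⟨ +-+-interchange (f 0) (g 0) _ _ ⟩
  (f 0 + Σ< n (f ∘ suc)) + (g 0 + Σ< n (g ∘ suc)) ≡⟨ cong₂ _+_ (Σ<-suc n f) (Σ<-suc n g) ⟨
  Σ< (suc n) f + Σ< (suc n) g                     ∎
  where
  +-+-interchange : ∀ a b c d → a + b + (c + d) ≡ a + c + (b + d)
  +-+-interchange = solve-∀

*-distribˡ-Σ< : ∀ n c (f : ℕ → ℕ) → c * Σ< n f ≡ Σ< n (λ k → c * f k)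
*-distribˡ-Σ< zero    c f = *-zeroʳ c
*-distribˡ-Σ< (suc n) c f = begin
  c * Σ< (suc n) f                   ≡⟨ cong (c *_) (Σ<-suc n f) ⟩
  c * (f 0 + Σ< n (f ∘ suc))         ≡⟨ *-distribˡ-+ c (f 0) _ ⟩
  c * f 0 + c * Σ< n (f ∘ suc)       ≡⟨ cong (c * f 0 +_) (*-distribˡ-Σ< n c (f ∘ suc)) ⟩
  c * f 0 + Σ< n (λ k → c * f (suc k)) ≡⟨ Σ<-suc n (λ k → c * f k) ⟨
  Σ< (suc n) (λ k → c * f k)         ∎

Σ<-reverse : ∀ n f → Σ< n f ≡ Σ< n (λ k → f (n ∸ suc k))
Σ<-reverse zero    f = refl
Σ<-reverse (suc n) f = begin
  Σ< (suc n) f                                ≡⟨ Σ<-suc n f ⟩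
  f 0 + Σ< n (f ∘ suc)                        ≡⟨ cong (f 0 +_) (Σ<-reverse n (f ∘ suc)) ⟩
  f 0 + Σ< n (λ k → f (suc (n ∸ suc k)))      ≡⟨ cong (f 0 +_) (Σ<-cong n (λ k<n → cong f (+-∸-assoc 1 k<n))) ⟨
  f 0 + Σ< n (λ k → f (n ∸ k))                ≡⟨ +-comm (f 0) _ ⟩
  Σ< n (λ k → f (n ∸ k)) + f 0                ≡⟨ cong (λ t → Σ< n (λ k → f (n ∸ k)) + f t) (n∸n≡0 n) ⟨
  Σ< n (λ k → f (n ∸ k)) + f (n ∸ n)          ≡⟨ Σ<-snoc n (λ k → f (n ∸ k)) ⟨
  Σ< (suc n) (λ k → f (suc n ∸ suc k))        ∎

Σ<-even-odd : ∀ n g → Σ< (2 * n) g ≡ Σ< n (λ i → g (2 * i)) + Σ< n (λ i → g (suc (2 * i)))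
Σ<-even-odd zero    g = refl
Σ<-even-odd (suc n) g = begin
  Σ< (2 * suc n) g                                  ≡⟨ cong (λ t → Σ< t g) (*-suc 2 n) ⟩
  Σ< (suc (suc (2 * n))) g                          ≡⟨ Σ<-suc (suc (2 * n)) g ⟩
  g 0 + Σ< (suc (2 * n)) (g ∘ suc)                  ≡⟨ cong (g 0 +_) (Σ<-suc (2 * n) (g ∘ suc)) ⟩
  g 0 + (g 1 + Σ< (2 * n) (g ∘ suc ∘ suc))          ≡⟨ cong (λ t → g 0 + (g 1 + t)) (Σ<-even-odd n (g ∘ suc ∘ suc)) ⟩
  g 0 + (g 1 + (Σ< n even′ + Σ< n odd′))            ≡⟨ regroup (g 0) (g 1) _ _ ⟩
  (g 0 + Σ< n even′) + (g 1 + Σ< n odd′)            ≡⟨ cong₂ (λ x y → (g 0 + x) + (g 1 + y))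
                                                         (Σ<-cong n λ {i} _ → cong g (sym (*-suc 2 i)))
                                                         (Σ<-cong n λ {i} _ → cong (g ∘ suc) (sym (*-suc 2 i))) ⟩
  (g 0 + Σ< n (λ i → g (2 * suc i))) + (g 1 + Σ< n (λ i → g (suc (2 * suc i))))
                                                    ≡⟨ cong₂ _+_ (Σ<-suc n (λ i → g (2 * i))) (Σ<-suc n (λ i → g (suc (2 * i)))) ⟨
  Σ< (suc n) (λ i → g (2 * i)) + Σ< (suc n) (λ i → g (suc (2 * i))) ∎
  where
  even′ odd′ : ℕ → ℕ
  even′ i = g (suc (suc (2 * i)))
  odd′  i = g (suc (suc (suc (2 * i))))
  regroup : ∀ a b c d → a + (b + (c + d)) ≡ (a + c) + (b + d)
  regroup = solve-∀

Σ<-even-odd-suc : ∀ n g → Σ< (suc (2 * n)) g ≡ Σ< (suc n) (λ i → g (2 * i)) + Σ< n (λ i → g (suc (2 * i)))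
Σ<-even-odd-suc n g = begin
  Σ< (suc (2 * n)) g                                ≡⟨ Σ<-snoc (2 * n) g ⟩
  Σ< (2 * n) g + g (2 * n)                          ≡⟨ cong (_+ g (2 * n)) (Σ<-even-odd n g) ⟩
  Σ< n even + Σ< n odd + g (2 * n)                  ≡⟨ +-right-comm (Σ< n even) (Σ< n odd) (g (2 * n)) ⟩
  Σ< n even + g (2 * n) + Σ< n odd                  ≡⟨ cong (_+ Σ< n odd) (Σ<-snoc n even) ⟨
  Σ< (suc n) even + Σ< n odd                        ∎
  where
  even odd : ℕ → ℕ
  even i = g (2 * i)
  odd  i = g (suc (2 * i))
  +-right-comm : ∀ a b c → a + b + c ≡ a + c + b
  +-right-comm = solve-∀

-- Self-convolution of the central binomial coefficients

B⋆B : ℕ → ℕ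
B⋆B m = Σ< (suc m) (λ k → B k * B (m ∸ k))

left-weighted-B⋆B : ∀ m →
  Σ< (suc (suc m)) (λ k → k * B k * B (suc m ∸ k)) ≡ Σ< (suc m) (λ k → 2 * suc (2 * k) * B k * B (m ∸ k))
left-weighted-B⋆B m = trans (Σ<-suc (suc m) (λ k → k * B k * B (suc m ∸ k)))
  (Σ<-cong (suc m) λ {k} _ → cong (_* B (m ∸ k)) ([1+m]*B[1+m]≡2[1+2m]*Bm k))

right-weighted-B⋆B : ∀ m →
  Σ< (suc (suc m)) (λ k → B k * ((suc m ∸ k) * B (suc m ∸ k))) ≡ Σ< (suc m) (λ k → B k * (2 * suc (2 * (m ∸ k)) * B (m ∸ k)))
right-weighted-B⋆B m = begin
  Σ< (suc (suc m)) f                 ≡⟨ Σ<-snoc (suc m) f ⟩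
  Σ< (suc m) f + f (suc m)           ≡⟨ cong (Σ< (suc m) f +_) last≡0 ⟩
  Σ< (suc m) f + 0                   ≡⟨ +-identityʳ _ ⟩
  Σ< (suc m) f                       ≡⟨ Σ<-cong (suc m) (λ {k} k≤m → cong (B k *_) (shift k≤m)) ⟩
  Σ< (suc m) (λ k → B k * (2 * suc (2 * (m ∸ k)) * B (m ∸ k))) ∎
  where
  f : ℕ → ℕ
  f k = B k * ((suc m ∸ k) * B (suc m ∸ k))
  last≡0 : f (suc m) ≡ 0
  last≡0 = trans (cong (λ t → B (suc m) * (t * B t)) (n∸n≡0 m)) (*-zeroʳ (B (suc m)))
  shift : ∀ {k} → k < suc m → (suc m ∸ k) * B (suc m ∸ k) ≡ 2 * suc (2 * (m ∸ k)) * B (m ∸ k)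
  shift {k} (s≤s k≤m) = trans (cong (λ t → t * B t) (+-∸-assoc 1 k≤m)) ([1+m]*B[1+m]≡2[1+2m]*Bm (m ∸ k))

B⋆B-suc : ∀ m → B⋆B (suc m) ≡ 4 * B⋆B m
B⋆B-suc m = *-cancelˡ-≡ _ _ (suc m) (begin
  suc m * B⋆B (suc m)                                  ≡⟨ *-distribˡ-Σ< (suc (suc m)) (suc m) (λ k → B k * B (suc m ∸ k)) ⟩
  Σ< (suc (suc m)) (λ k → suc m * (B k * B (suc m ∸ k))) ≡⟨ Σ<-cong (suc (suc m)) split-weight ⟩
  Σ< (suc (suc m)) (λ k → left k + right k)            ≡⟨ Σ<-+ (suc (suc m)) left right ⟩
  Σ< (suc (suc m)) left + Σ< (suc (suc m)) right       ≡⟨ cong₂ _+_ (left-weighted-B⋆B m) (right-weighted-B⋆B m) ⟩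
  Σ< (suc m) left′ + Σ< (suc m) right′                 ≡⟨ Σ<-+ (suc m) left′ right′ ⟨
  Σ< (suc m) (λ k → left′ k + right′ k)                ≡⟨ Σ<-cong (suc m) join-weight ⟩
  Σ< (suc m) (λ k → 4 * suc m * (B k * B (m ∸ k)))     ≡⟨ *-distribˡ-Σ< (suc m) (4 * suc m) (λ k → B k * B (m ∸ k)) ⟨
  4 * suc m * B⋆B m                                    ≡⟨ 4*a*x≡a*[4*x] (suc m) (B⋆B m) ⟩
  suc m * (4 * B⋆B m)                                  ∎)
  where
  distribute : ∀ k d a b → (k + d) * (a * b) ≡ k * a * b + a * (d * b)
  distribute = solve-∀
  collect : ∀ k d a b → 2 * suc (2 * k) * a * b + a * (2 * suc (2 * d) * b) ≡ 4 * suc (k + d) * (a * b)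
  collect = solve-∀
  left right left′ right′ : ℕ → ℕ
  left k = k * B k * B (suc m ∸ k)
  right k = B k * ((suc m ∸ k) * B (suc m ∸ k))
  left′ k = 2 * suc (2 * k) * B k * B (m ∸ k)
  right′ k = B k * (2 * suc (2 * (m ∸ k)) * B (m ∸ k))
  split-weight : ∀ {k} → k < suc (suc m) → suc m * (B k * B (suc m ∸ k)) ≡ left k + right k
  split-weight {k} (s≤s k≤1+m) = begin
    suc m * (B k * B (suc m ∸ k))                  ≡⟨ cong (_* (B k * B (suc m ∸ k))) (m+[n∸m]≡n k≤1+m) ⟨
    (k + (suc m ∸ k)) * (B k * B (suc m ∸ k))      ≡⟨ distribute k (suc m ∸ k) (B k) (B (suc m ∸ k)) ⟩
    left k + right k                               ∎
  join-weight : ∀ {k} → k < suc m → left′ k + right′ k ≡ 4 * suc m * (B k * B (m ∸ k))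
  join-weight {k} (s≤s k≤m) = begin
    left′ k + right′ k                             ≡⟨ collect k (m ∸ k) (B k) (B (m ∸ k)) ⟩
    4 * suc (k + (m ∸ k)) * (B k * B (m ∸ k))      ≡⟨ cong (λ t → 4 * suc t * (B k * B (m ∸ k))) (m+[n∸m]≡n k≤m) ⟩
    4 * suc m * (B k * B (m ∸ k))                  ∎
  4*a*x≡a*[4*x] : ∀ a x → 4 * a * x ≡ a * (4 * x)
  4*a*x≡a*[4*x] = solve-∀

B⋆B≡4^m : ∀ m → B⋆B m ≡ 4 ^ m
B⋆B≡4^m zero    = refl
B⋆B≡4^m (suc m) = trans (B⋆B-suc m) (cong (4 *_) (B⋆B≡4^m m))

Σ<-Cat-B : ∀ n (a w : ℕ → ℕ) →
  2 * Σ< n (λ i → Cat (a i) * w i) + Σ< n (λ i → B (suc (a i)) * w i) ≡ 4 * Σ< n (λ i → B (a i) * w i)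
Σ<-Cat-B n a w = begin
  2 * Σ< n (λ i → Cat (a i) * w i) + Σ< n (λ i → B (suc (a i)) * w i)
    ≡⟨ cong (_+ Σ< n (λ i → B (suc (a i)) * w i)) (*-distribˡ-Σ< n 2 (λ i → Cat (a i) * w i)) ⟩
  Σ< n (λ i → 2 * (Cat (a i) * w i)) + Σ< n (λ i → B (suc (a i)) * w i)
    ≡⟨ Σ<-+ n (λ i → 2 * (Cat (a i) * w i)) (λ i → B (suc (a i)) * w i) ⟨
  Σ< n (λ i → 2 * (Cat (a i) * w i) + B (suc (a i)) * w i)
    ≡⟨ Σ<-cong n (λ {i} _ → pointwise i) ⟩
  Σ< n (λ i → 4 * (B (a i) * w i))
    ≡⟨ *-distribˡ-Σ< n 4 (λ i → B (a i) * w i) ⟨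
  4 * Σ< n (λ i → B (a i) * w i) ∎
  where
  factor : ∀ c b x → 2 * (c * x) + b * x ≡ (2 * c + b) * x
  factor = solve-∀
  pointwise : ∀ i → 2 * (Cat (a i) * w i) + B (suc (a i)) * w i ≡ 4 * (B (a i) * w i)
  pointwise i = begin
    2 * (Cat (a i) * w i) + B (suc (a i)) * w i  ≡⟨ factor (Cat (a i)) (B (suc (a i))) (w i) ⟩
    (2 * Cat (a i) + B (suc (a i))) * w i        ≡⟨ cong (_* w i) (2*Cat+B[1+m]≡4*B (a i)) ⟩
    4 * B (a i) * w i                            ≡⟨ *-assoc 4 (B (a i)) (w i) ⟩
    4 * (B (a i) * w i)                          ∎

-- Parity classes of the convolution

evenEven oddOdd oddEven catEven : ℕ → ℕ
evenEven n = Σ< (suc n) (λ i → B (2 * i) * B (2 * (n ∸ i)))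
oddOdd   n = Σ< n (λ i → B (2 * i + 1) * B (2 * (n ∸ i) ∸ 1))
oddEven  n = Σ< (suc n) (λ i → B (suc (2 * i)) * B (2 * (n ∸ i)))
catEven  n = Σ< (suc n) (λ i → Cat (2 * i) * B (2 * (n ∸ i)))

B⋆B[2n]≡evenEven+oddOdd : ∀ n → B⋆B (2 * n) ≡ evenEven n + oddOdd n
B⋆B[2n]≡evenEven+oddOdd n = begin
  B⋆B (2 * n)                                                  ≡⟨ Σ<-even-odd-suc n g ⟩
  Σ< (suc n) (λ i → g (2 * i)) + Σ< n (λ i → g (suc (2 * i)))  ≡⟨ cong₂ _+_ (Σ<-cong (suc n) λ {i} _ → even i)
                                                                            (Σ<-cong n λ {i} _ → odd i) ⟩
  evenEven n + oddOdd n                                        ∎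
  where
  g : ℕ → ℕ
  g k = B k * B (2 * n ∸ k)
  even : ∀ i → g (2 * i) ≡ B (2 * i) * B (2 * (n ∸ i))
  even i = cong (λ t → B (2 * i) * B t) (sym (*-distribˡ-∸ 2 n i))
  odd : ∀ i → g (suc (2 * i)) ≡ B (2 * i + 1) * B (2 * (n ∸ i) ∸ 1)
  odd i = begin
    B (suc (2 * i)) * B (2 * n ∸ suc (2 * i))        ≡⟨ cong (λ t → B t * B (2 * n ∸ t)) (+-comm 1 (2 * i)) ⟩
    B (2 * i + 1) * B (2 * n ∸ (2 * i + 1))          ≡⟨ cong (λ t → B (2 * i + 1) * B t) (∸-+-assoc (2 * n) (2 * i) 1) ⟨
    B (2 * i + 1) * B (2 * n ∸ 2 * i ∸ 1)            ≡⟨ cong (λ t → B (2 * i + 1) * B (t ∸ 1)) (*-distribˡ-∸ 2 n i) ⟨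
    B (2 * i + 1) * B (2 * (n ∸ i) ∸ 1)              ∎

B⋆B[1+2n]≡2*oddEven : ∀ n → B⋆B (suc (2 * n)) ≡ 2 * oddEven n
B⋆B[1+2n]≡2*oddEven n = begin
  B⋆B (suc (2 * n))                                                    ≡⟨ cong (λ t → Σ< t g) (*-suc 2 n) ⟨
  Σ< (2 * suc n) g                                                     ≡⟨ Σ<-even-odd (suc n) g ⟩
  Σ< (suc n) (λ i → g (2 * i)) + Σ< (suc n) (λ i → g (suc (2 * i)))    ≡⟨ cong (_+ Σ< (suc n) (λ i → g (suc (2 * i)))) (Σ<-reverse (suc n) (λ i → g (2 * i))) ⟩
  Σ< (suc n) (λ i → g (2 * (n ∸ i))) + Σ< (suc n) (λ i → g (suc (2 * i))) ≡⟨ cong₂ _+_ (Σ<-cong (suc n) reflected) (Σ<-cong (suc n) λ {i} _ → odd i) ⟩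
  oddEven n + oddEven n                                                ≡⟨ cong (oddEven n +_) (+-identityʳ (oddEven n)) ⟨
  2 * oddEven n                                                        ∎
  where
  g : ℕ → ℕ
  g k = B k * B (suc (2 * n) ∸ k)
  odd : ∀ i → g (suc (2 * i)) ≡ B (suc (2 * i)) * B (2 * (n ∸ i))
  odd i = cong (λ t → B (suc (2 * i)) * B t) (sym (*-distribˡ-∸ 2 n i))
  unfold : ∀ i d → suc (2 * (i + d)) ≡ suc (2 * i) + 2 * d
  unfold = solve-∀
  complement : ∀ {i} → i ≤ n → suc (2 * n) ∸ 2 * (n ∸ i) ≡ suc (2 * i)
  complement {i} i≤n = begin
    suc (2 * n) ∸ 2 * (n ∸ i)                  ≡⟨ cong (λ t → suc (2 * t) ∸ 2 * (n ∸ i)) (m+[n∸m]≡n i≤n) ⟨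
    suc (2 * (i + (n ∸ i))) ∸ 2 * (n ∸ i)      ≡⟨ cong (_∸ 2 * (n ∸ i)) (unfold i (n ∸ i)) ⟩
    suc (2 * i) + 2 * (n ∸ i) ∸ 2 * (n ∸ i)    ≡⟨ m+n∸n≡m (suc (2 * i)) (2 * (n ∸ i)) ⟩
    suc (2 * i)                                ∎
  reflected : ∀ {i} → i < suc n → g (2 * (n ∸ i)) ≡ B (suc (2 * i)) * B (2 * (n ∸ i))
  reflected {i} (s≤s i≤n) = trans (cong (λ t → B (2 * (n ∸ i)) * B t) (complement i≤n)) (*-comm (B (2 * (n ∸ i))) _)

oddEven≡2*[evenEven+oddOdd] : ∀ n → oddEven n ≡ 2 * (evenEven n + oddOdd n)
oddEven≡2*[evenEven+oddOdd] n = *-cancelˡ-≡ _ _ 2 (begin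
  2 * oddEven n                        ≡⟨ B⋆B[1+2n]≡2*oddEven n ⟨
  B⋆B (suc (2 * n))                    ≡⟨ B⋆B≡4^m (suc (2 * n)) ⟩
  4 * 4 ^ (2 * n)                      ≡⟨ cong (4 *_) (B⋆B≡4^m (2 * n)) ⟨
  4 * B⋆B (2 * n)                      ≡⟨ cong (4 *_) (B⋆B[2n]≡evenEven+oddOdd n) ⟩
  4 * (evenEven n + oddOdd n)          ≡⟨ *-assoc 2 2 (evenEven n + oddOdd n) ⟩
  2 * (2 * (evenEven n + oddOdd n))    ∎)

evenEven≡catEven+oddOdd : ∀ n → evenEven n ≡ catEven n + oddOdd n
evenEven≡catEven+oddOdd n = sym (*-cancelˡ-≡ _ _ 2 (+-cancelʳ-≡ (2 * EE) _ _ (begin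
  2 * (CE + OO) + 2 * EE    ≡⟨ regroup CE OO EE ⟩
  2 * CE + 2 * (EE + OO)    ≡⟨ cong (2 * CE +_) (oddEven≡2*[evenEven+oddOdd] n) ⟨
  2 * CE + oddEven n        ≡⟨ Σ<-Cat-B (suc n) (2 *_) (λ i → B (2 * (n ∸ i))) ⟩
  4 * EE                    ≡⟨ double EE ⟩
  2 * EE + 2 * EE           ∎)))
  where
  EE = evenEven n
  OO = oddOdd n
  CE = catEven n
  regroup : ∀ c o e → 2 * (c + o) + 2 * e ≡ 2 * c + 2 * (e + o)
  regroup = solve-∀
  double : ∀ e → 4 * e ≡ 2 * e + 2 * e
  double = solve-∀

-- Imported this late because ℤ's prefix +_ makes ℕ sections such as (x + y +_) ambiguous.
open import Data.Integer using (+_; _-_; _⊖_)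
import Data.Integer.Properties as ℤ

+[m+n]-+n≡+m : ∀ m n → + (m + n) - + n ≡ + m
+[m+n]-+n≡+m m n = begin
  + (m + n) - + n   ≡⟨ ℤ.[+m]-[+n]≡m⊖n (m + n) n ⟩
  (m + n) ⊖ n       ≡⟨ ℤ.⊖-≥ (m≤n+m n m) ⟩
  + (m + n ∸ n)     ≡⟨ cong +_ (m+n∸n≡m m n) ⟩
  + m               ∎

theorem9 : (n : ℕ) →
    (+ Σ< (suc n) (λ i → B (2 * i) * B (2 * (n ∸ i))))
      - (+ Σ< n (λ i → B (2 * i + 1) * B (2 * (n ∸ i) ∸ 1)))
    ≡ + Σ< (suc n) (λ i → Cat (2 * i) * B (2 * (n ∸ i)))
theorem9 n = begin
  + evenEven n - + oddOdd n              ≡⟨ cong (λ t → + t - + oddOdd n) (evenEven≡catEven+oddOdd n) ⟩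
  + (catEven n + oddOdd n) - + oddOdd n  ≡⟨ +[m+n]-+n≡+m (catEven n) (oddOdd n) ⟩
  + catEven n                            ∎
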